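{- For a game $G$: if $G$ is of type $\mathcal P$, $\mathcal N$ or $\mathcal O$, then $G+G+G$ is of type $\mathcal P$ or $\mathcal Q$; if $G$ is of type $\mathcal Q$, then $G+G+G$ is of type $\mathcal Q$. Moreover, for each of the types $\mathcal P,\mathcal N,\mathcal O$ of $G$, both possibilities $\mathcal P$ and $\mathcal Q$ for $G+G+G$ occur.
   Context: A (finite impartial) game is defined recursively as a finite set of games, its options; $0$ is the game with no options. Three players alternate moves cyclically; a move replaces the current game by one of its options, and the player who makes the last move wins. The disjunctive sum $G+H$ is the game whose options are all $G'+H$ ($G'$ an option of $G$) and all $G+H'$ ($H'$ an option of $H$). Types are defined recursively: $G$ is of type $\mathcal N$ iff it has some option of type $\mathcal P$; of type $\mathcal O$ iff it has at least one option and all its options are of type $\mathcal N$; of type $\mathcal P$ iff all its options are of type $\mathcal O$ (so $0$ is of type $\mathcal P$); of type $\mathcal Q$ otherwise. -}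

module Defs where
open import Data.List using (List; []; _∷_; _++_)
open import Data.Bool using (Bool; true; false; _∧_; _∨_)

-- A finite impartial game, given by its (finite) list of options.
-- (A list rather than a set: repetitions/order are irrelevant for the type.)
data Game : Set where
  mk : List Game → Game

data GType : Set where
  𝒫 𝒩 𝒪 𝒬 : GType

isP isN : GType → Bool
isP 𝒫 = true
isP _ = false
isN 𝒩 = true
isN _ = false
isO : GType → Bool
isO 𝒪 = true
isO _ = false

anyP allN allO : List GType → Bool
anyP [] = false
anyP (t ∷ ts) = isP t ∨ anyP ts
allN [] = true
allN (t ∷ ts) = isN t ∧ allN ts
allO [] = true
allO (t ∷ ts) = isO t ∧ allO ts

nonEmpty : List GType → Bool
nonEmpty [] = false
nonEmpty (_ ∷ _) = true

classify : List GType → GType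
classify ts with anyP ts
... | true = 𝒩
... | false with nonEmpty ts ∧ allN ts
...   | true = 𝒪
...   | false with allO ts
...     | true = 𝒫
...     | false = 𝒬

mutual
  typeOf : Game → GType
  typeOf (mk gs) = classify (typesOf gs)

  typesOf : List Game → List GType
  typesOf [] = []
  typesOf (g ∷ gs) = typeOf g ∷ typesOf gs

mutual
  _⊕_ : Game → Game → Game
  G@(mk gs) ⊕ H@(mk hs) = mk (leftOpts gs H ++ rightOpts G hs)
  infixl 6 _⊕_

  leftOpts : List Game → Game → List Game
  leftOpts [] h = []
  leftOpts (g ∷ gs) h = (g ⊕ h) ∷ leftOpts gs h

  rightOpts : Game → List Game → List Game
  rightOpts g [] = []
  rightOpts g (h ∷ hs) = (g ⊕ h) ∷ rightOpts g hs

{-# OPTIONS --safe #-}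
module Submission where

-- G ⊕ G ⊕ G is never 𝒩: whatever option g of one copy the first player moves to, the next two
-- players can move to g in the other two copies, reaching g ⊕ g ⊕ g, which is not 𝒩 by induction;
-- so the position after two moves is not 𝒪, and the one after the first move is not 𝒫. It is never
-- 𝒪 either, by a case analysis on the types of G and G ⊕ G resting on rules, proved by induction on
-- the summands, for how a summand of known type constrains the type of a sum: a 𝒫-summand creates
-- none of the types 𝒫, 𝒩, 𝒪; a 𝒬-summand excludes 𝒫; G ⊕ G is not 𝒩 if G is 𝒩 and not 𝒪 if G is 𝒪.
-- Since a 𝒬-summand excludes 𝒫, G ⊕ G ⊕ G is 𝒬 when G is.

open import Defs
open import Data.Bool using (Bool; true; false; _∧_; _∨_)
open import Data.Bool.Properties using (∨-zeroʳ; ⇔→≡)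
open import Data.List using (List; []; _∷_)
open import Data.List.Membership.Propositional using (_∈_)
open import Data.List.Membership.Propositional.Properties using (∈-++⁺ˡ; ∈-++⁺ʳ; ∈-++⁻)
open import Data.List.Relation.Binary.Subset.Propositional using (_⊆_)
open import Data.List.Relation.Unary.Any using (here; there)
open import Data.Product using (_×_; ∃; ∃-syntax; _,_; -,_; proj₂)
open import Data.Sum using (_⊎_; inj₁; inj₂; [_,_]′)
open import Function using (_∘_)
open import Function.Bundles using (mk⇔)
open import Induction.WellFounded using (Acc; acc; WellFounded)
open import Relation.Binary.PropositionalEquality using (_≡_; _≢_; refl; sym; trans; cong; subst)
open import Relation.Nullary using (contradiction)

variable
  G H K g h : Game
  s t u : GType
  ts us : List GType

≡-≢-trans : s ≡ t → t ≢ u → s ≢ u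
≡-≢-trans refl t≢u = t≢u

≢𝒫-≢𝒪⇒𝒩⊎𝒬 : t ≢ 𝒫 → t ≢ 𝒪 → t ≡ 𝒩 ⊎ t ≡ 𝒬
≢𝒫-≢𝒪⇒𝒩⊎𝒬 {𝒫} t≢𝒫 _   = contradiction refl t≢𝒫
≢𝒫-≢𝒪⇒𝒩⊎𝒬 {𝒩} _   _   = inj₁ refl
≢𝒫-≢𝒪⇒𝒩⊎𝒬 {𝒪} _   t≢𝒪 = contradiction refl t≢𝒪
≢𝒫-≢𝒪⇒𝒩⊎𝒬 {𝒬} _   _   = inj₂ refl

anyP⁺ : 𝒫 ∈ ts → anyP ts ≡ true
anyP⁺ (here refl)             = refl
anyP⁺ {t ∷ _} (there 𝒫∈ts) = trans (cong (isP t ∨_) (anyP⁺ 𝒫∈ts)) (∨-zeroʳ (isP t))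

anyP⁻ : ∀ ts → anyP ts ≡ true → 𝒫 ∈ ts
anyP⁻ (𝒫 ∷ _)  _ = here refl
anyP⁻ (𝒩 ∷ ts) e = there (anyP⁻ ts e)
anyP⁻ (𝒪 ∷ ts) e = there (anyP⁻ ts e)
anyP⁻ (𝒬 ∷ ts) e = there (anyP⁻ ts e)

allN⁺ : ∀ ts → (∀ {t} → t ∈ ts → t ≡ 𝒩) → allN ts ≡ true
allN⁺ []       _    = refl
allN⁺ (t ∷ ts) all𝒩 rewrite all𝒩 (here refl) = allN⁺ ts (all𝒩 ∘ there)

allN⁻ : ∀ ts → allN ts ≡ true → t ∈ ts → t ≡ 𝒩
allN⁻ (𝒩 ∷ _)  _  (here refl) = refl
allN⁻ (𝒩 ∷ ts) e  (there t∈ts) = allN⁻ ts e t∈ts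
allN⁻ (𝒫 ∷ _)  () _
allN⁻ (𝒪 ∷ _)  () _
allN⁻ (𝒬 ∷ _)  () _

allN≡false⁻ : ∀ ts → allN ts ≡ false → ∃[ t ] t ∈ ts × t ≢ 𝒩
allN≡false⁻ (𝒩 ∷ ts) e = let t , t∈ts , t≢𝒩 = allN≡false⁻ ts e in t , there t∈ts , t≢𝒩
allN≡false⁻ (𝒫 ∷ _)  _ = 𝒫 , here refl , λ ()
allN≡false⁻ (𝒪 ∷ _)  _ = 𝒪 , here refl , λ ()
allN≡false⁻ (𝒬 ∷ _)  _ = 𝒬 , here refl , λ ()

allO⁺ : ∀ ts → (∀ {t} → t ∈ ts → t ≡ 𝒪) → allO ts ≡ true
allO⁺ []       _    = refl
allO⁺ (t ∷ ts) all𝒪 rewrite all𝒪 (here refl) = allO⁺ ts (all𝒪 ∘ there)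

allO⁻ : ∀ ts → allO ts ≡ true → t ∈ ts → t ≡ 𝒪
allO⁻ (𝒪 ∷ _)  _  (here refl) = refl
allO⁻ (𝒪 ∷ ts) e  (there t∈ts) = allO⁻ ts e t∈ts
allO⁻ (𝒫 ∷ _)  () _
allO⁻ (𝒩 ∷ _)  () _
allO⁻ (𝒬 ∷ _)  () _

allO≡false⁻ : ∀ ts → allO ts ≡ false → ∃[ t ] t ∈ ts × t ≢ 𝒪
allO≡false⁻ (𝒪 ∷ ts) e = let t , t∈ts , t≢𝒪 = allO≡false⁻ ts e in t , there t∈ts , t≢𝒪
allO≡false⁻ (𝒫 ∷ _)  _ = 𝒫 , here refl , λ ()
allO≡false⁻ (𝒩 ∷ _)  _ = 𝒩 , here refl , λ ()
allO≡false⁻ (𝒬 ∷ _)  _ = 𝒬 , here refl , λ ()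

-- A with-free form of classify, so that its three tests can be rewritten separately.
classifyBy : Bool → Bool → Bool → GType
classifyBy true  _     _     = 𝒩
classifyBy false true  _     = 𝒪
classifyBy false false true  = 𝒫
classifyBy false false false = 𝒬

classify≡classifyBy : ∀ ts → classify ts ≡ classifyBy (anyP ts) (nonEmpty ts ∧ allN ts) (allO ts)
classify≡classifyBy ts with anyP ts
... | true = refl
... | false with nonEmpty ts ∧ allN ts
...   | true = refl
...   | false with allO ts
...     | true  = refl
...     | false = refl

classify-cong : ts ⊆ us → us ⊆ ts → classify ts ≡ classify us
classify-cong {ts} {us} ts⊆us us⊆ts =
  trans (classify≡classifyBy ts) (trans tests≡ (sym (classify≡classifyBy us)))
  where
  same : ∀ (f : List GType → Bool) → (∀ {xs ys} → xs ⊆ ys → ys ⊆ xs → f xs ≡ true → f ys ≡ true) →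
         f ts ≡ f us
  same f pres = ⇔→≡ (mk⇔ (pres ts⊆us us⊆ts) (pres us⊆ts ts⊆us))
  anyP-mono : ∀ {xs ys} → xs ⊆ ys → ys ⊆ xs → anyP xs ≡ true → anyP ys ≡ true
  anyP-mono xs⊆ys _ e = anyP⁺ (xs⊆ys (anyP⁻ _ e))
  nonEmpty-mono : ∀ {xs ys} → xs ⊆ ys → ys ⊆ xs → nonEmpty xs ≡ true → nonEmpty ys ≡ true
  nonEmpty-mono {_ ∷ _} xs⊆ys _ _ with xs⊆ys (here refl)
  ... | here _  = refl
  ... | there _ = refl
  allN-anti : ∀ {xs ys} → xs ⊆ ys → ys ⊆ xs → allN xs ≡ true → allN ys ≡ true
  allN-anti _ ys⊆xs e = allN⁺ _ (allN⁻ _ e ∘ ys⊆xs)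
  allO-anti : ∀ {xs ys} → xs ⊆ ys → ys ⊆ xs → allO xs ≡ true → allO ys ≡ true
  allO-anti _ ys⊆xs e = allO⁺ _ (allO⁻ _ e ∘ ys⊆xs)
  tests≡ : classifyBy (anyP ts) (nonEmpty ts ∧ allN ts) (allO ts) ≡
           classifyBy (anyP us) (nonEmpty us ∧ allN us) (allO us)
  tests≡ rewrite same anyP anyP-mono | same nonEmpty nonEmpty-mono
               | same allN allN-anti | same allO allO-anti = refl

classify-constant : t ∈ ts → (∀ {u} → u ∈ ts → u ≡ t) → classify ts ≡ classify (t ∷ [])
classify-constant t∈ts ≡t = classify-cong (here ∘ ≡t) λ { (here refl) → t∈ts ; (there ()) }

classify≡𝒩⁺ : 𝒫 ∈ ts → classify ts ≡ 𝒩
classify≡𝒩⁺ {ts} 𝒫∈ts rewrite classify≡classifyBy ts | anyP⁺ 𝒫∈ts = refl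

classify≡𝒩⁻ : ∀ ts → classify ts ≡ 𝒩 → 𝒫 ∈ ts
classify≡𝒩⁻ ts e = anyP⁻ ts (inv _ _ _ (trans (sym (classify≡classifyBy ts)) e))
  where
  inv : ∀ a b c → classifyBy a b c ≡ 𝒩 → a ≡ true
  inv true  _     _     _  = refl
  inv false true  _     ()
  inv false false true  ()
  inv false false false ()

classify≡𝒪⁻ : ∀ ts → classify ts ≡ 𝒪 → t ∈ ts → t ≡ 𝒩
classify≡𝒪⁻ []         ()
classify≡𝒪⁻ ts@(_ ∷ _) e = allN⁻ ts (inv _ _ _ (trans (sym (classify≡classifyBy ts)) e))
  where
  inv : ∀ a b c → classifyBy a b c ≡ 𝒪 → b ≡ true
  inv true  _     _     ()
  inv false true  _     _  = refl
  inv false false true  ()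
  inv false false false ()

classify≡𝒫⁻ : ∀ ts → classify ts ≡ 𝒫 → t ∈ ts → t ≡ 𝒪
classify≡𝒫⁻ ts e = allO⁻ ts (inv _ _ _ (trans (sym (classify≡classifyBy ts)) e))
  where
  inv : ∀ a b c → classifyBy a b c ≡ 𝒫 → c ≡ true
  inv true  _     _     ()
  inv false true  _     ()
  inv false false true  _  = refl
  inv false false false ()

classify≢𝒫⁻ : ∀ ts → classify ts ≢ 𝒫 → ∃[ t ] t ∈ ts × t ≢ 𝒪
classify≢𝒫⁻ []         ≢𝒫 = contradiction refl ≢𝒫
classify≢𝒫⁻ ts@(_ ∷ _) ≢𝒫 with allO ts in e
... | false = allO≡false⁻ ts e
... | true  = contradiction (classify-constant (here (sym (allO⁻ ts e (here refl)))) (allO⁻ ts e)) ≢𝒫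

classify≢𝒪⁻ : ∀ ts → classify ts ≢ 𝒪 → ts ≡ [] ⊎ ∃[ t ] t ∈ ts × t ≢ 𝒩
classify≢𝒪⁻ []         _   = inj₁ refl
classify≢𝒪⁻ ts@(_ ∷ _) ≢𝒪 with allN ts in e
... | false = inj₂ (allN≡false⁻ ts e)
... | true  = contradiction (classify-constant (here (sym (allN⁻ ts e (here refl)))) (allN⁻ ts e)) ≢𝒪

-- A data type rather than g ∈ opts G, so that G can be inferred from a proof of g ◃ G.
infix 4 _◃_
data _◃_ (g : Game) : Game → Set where
  opt : ∀ {gs} → g ∈ gs → g ◃ mk gs

◃-wellFounded : WellFounded _◃_
◃-wellFounded (mk gs) = acc λ { (opt g∈gs) → ∈-acc g∈gs }
  where
  ∈-acc : ∀ {g gs} → g ∈ gs → Acc _◃_ g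
  ∈-acc {gs = g ∷ _} (here refl) = ◃-wellFounded g
  ∈-acc (there g∈gs) = ∈-acc g∈gs

∈-typesOf⁺ : ∀ {gs} → g ◃ mk gs → typeOf g ∈ typesOf gs
∈-typesOf⁺ (opt (here refl))  = here refl
∈-typesOf⁺ (opt (there g∈gs)) = there (∈-typesOf⁺ (opt g∈gs))

∈-typesOf⁻ : ∀ gs → t ∈ typesOf gs → ∃[ g ] g ◃ mk gs × typeOf g ≡ t
∈-typesOf⁻ (g ∷ _)  (here refl) = g , opt (here refl) , refl
∈-typesOf⁻ (_ ∷ gs) (there t∈ts) with ∈-typesOf⁻ gs t∈ts
... | g , opt g∈gs , e = g , opt (there g∈gs) , e

𝒩-intro : g ◃ G → typeOf g ≡ 𝒫 → typeOf G ≡ 𝒩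
𝒩-intro g◃G@(opt _) g𝒫 = classify≡𝒩⁺ (subst (_∈ _) g𝒫 (∈-typesOf⁺ g◃G))

𝒩-elim : ∀ G → typeOf G ≡ 𝒩 → ∃[ g ] g ◃ G × typeOf g ≡ 𝒫
𝒩-elim (mk gs) e = ∈-typesOf⁻ gs (classify≡𝒩⁻ _ e)

𝒪-elim : ∀ G → typeOf G ≡ 𝒪 → (∃[ g ] g ◃ G) × (∀ {g} → g ◃ G → typeOf g ≡ 𝒩)
𝒪-elim (mk [])      ()
𝒪-elim (mk (g ∷ _)) e = (g , opt (here refl)) , λ g◃G → classify≡𝒪⁻ _ e (∈-typesOf⁺ g◃G)

𝒫-elim : ∀ G → typeOf G ≡ 𝒫 → g ◃ G → typeOf g ≡ 𝒪
𝒫-elim (mk _) e g◃G = classify≡𝒫⁻ _ e (∈-typesOf⁺ g◃G)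

≢𝒫-elim : ∀ G → typeOf G ≢ 𝒫 → ∃[ g ] g ◃ G × typeOf g ≢ 𝒪
≢𝒫-elim (mk gs) ≢𝒫 =
  let t , t∈ts , t≢𝒪 = classify≢𝒫⁻ _ ≢𝒫
      g , g◃G , e = ∈-typesOf⁻ gs t∈ts
  in g , g◃G , ≡-≢-trans e t≢𝒪

≢𝒪-elim : ∀ G → typeOf G ≢ 𝒪 → G ≡ mk [] ⊎ ∃[ g ] g ◃ G × typeOf g ≢ 𝒩
≢𝒪-elim (mk [])      _   = inj₁ refl
≢𝒪-elim (mk gs@(_ ∷ _)) ≢𝒪 with classify≢𝒪⁻ _ ≢𝒪
... | inj₂ (t , t∈ts , t≢𝒩) =
  let g , g◃G , e = ∈-typesOf⁻ gs t∈ts in inj₂ (g , g◃G , ≡-≢-trans e t≢𝒩)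

≢𝒩-intro : (∀ {g} → g ◃ G → typeOf g ≢ 𝒫) → typeOf G ≢ 𝒩
≢𝒩-intro {G} no𝒫 e = let _ , g◃G , g𝒫 = 𝒩-elim G e in no𝒫 g◃G g𝒫

≢𝒩-elim : typeOf G ≢ 𝒩 → g ◃ G → typeOf g ≢ 𝒫
≢𝒩-elim G≢𝒩 g◃G g𝒫 = G≢𝒩 (𝒩-intro g◃G g𝒫)

≢𝒪-intro : g ◃ G → typeOf g ≢ 𝒩 → typeOf G ≢ 𝒪
≢𝒪-intro {G = G} g◃G g≢𝒩 e = g≢𝒩 (proj₂ (𝒪-elim G e) g◃G)

≢𝒫-intro : g ◃ G → typeOf g ≢ 𝒪 → typeOf G ≢ 𝒫
≢𝒫-intro {G = G} g◃G g≢𝒪 e = g≢𝒪 (𝒫-elim G e g◃G)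

𝒬-elim : ∀ G → typeOf G ≡ 𝒬 → ∃[ g ] g ◃ G × (typeOf g ≡ 𝒩 ⊎ typeOf g ≡ 𝒬)
𝒬-elim G G𝒬 =
  let g , g◃G , g≢𝒪 = ≢𝒫-elim G (≡-≢-trans G𝒬 λ ())
  in g , g◃G , ≢𝒫-≢𝒪⇒𝒩⊎𝒬 (≢𝒩-elim (≡-≢-trans G𝒬 λ ()) g◃G) g≢𝒪

infix 4 _≲_ _∈ᵀ_
_∈ᵀ_ : Game → Game → Set
g ∈ᵀ H = ∃[ h ] h ◃ H × typeOf g ≡ typeOf h

_≲_ : Game → Game → Set
G ≲ H = ∀ {g} → g ◃ G → g ∈ᵀ H

typeOf-cong : ∀ G H → G ≲ H → H ≲ G → typeOf G ≡ typeOf H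
typeOf-cong (mk gs) (mk hs) G≲H H≲G = classify-cong (≲⇒⊆ G≲H) (≲⇒⊆ H≲G)
  where
  ≲⇒⊆ : ∀ {gs hs} → mk gs ≲ mk hs → typesOf gs ⊆ typesOf hs
  ≲⇒⊆ {gs} ≲ t∈ts with ∈-typesOf⁻ gs t∈ts
  ... | g , g◃G , refl = let h , h◃H , e = ≲ g◃G in subst (_∈ _) (sym e) (∈-typesOf⁺ h◃H)

◃-⊕⁺ˡ : ∀ H → g ◃ G → g ⊕ H ◃ G ⊕ H
◃-⊕⁺ˡ (mk hs) (opt g∈gs) = opt (∈-++⁺ˡ (∈-leftOpts g∈gs))
  where
  ∈-leftOpts : ∀ {g gs} → g ∈ gs → g ⊕ mk hs ∈ leftOpts gs (mk hs)
  ∈-leftOpts (here refl)  = here refl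
  ∈-leftOpts (there g∈gs) = there (∈-leftOpts g∈gs)

◃-⊕⁺ʳ : ∀ G → h ◃ H → G ⊕ h ◃ G ⊕ H
◃-⊕⁺ʳ (mk gs) (opt h∈hs) = opt (∈-++⁺ʳ (leftOpts gs _) (∈-rightOpts h∈hs))
  where
  ∈-rightOpts : ∀ {h hs} → h ∈ hs → mk gs ⊕ h ∈ rightOpts (mk gs) hs
  ∈-rightOpts (here refl)  = here refl
  ∈-rightOpts (there h∈hs) = there (∈-rightOpts h∈hs)

◃-⊕-elim : ∀ {P : Game → Set} G H →
           (∀ {g} → g ◃ G → P (g ⊕ H)) → (∀ {h} → h ◃ H → P (G ⊕ h)) →
           ∀ {x} → x ◃ G ⊕ H → P x
◃-⊕-elim {P} (mk gs) (mk hs) left right (opt x∈xs) =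
  [ leftOpts-elim (left ∘ opt) , rightOpts-elim (right ∘ opt) ]′ (∈-++⁻ (leftOpts gs (mk hs)) x∈xs)
  where
  leftOpts-elim : ∀ {gs} → (∀ {g} → g ∈ gs → P (g ⊕ mk hs)) → ∀ {x} → x ∈ leftOpts gs (mk hs) → P x
  leftOpts-elim {_ ∷ _} f (here refl) = f (here refl)
  leftOpts-elim {_ ∷ _} f (there x∈xs) = leftOpts-elim (f ∘ there) x∈xs
  rightOpts-elim : ∀ {hs} → (∀ {h} → h ∈ hs → P (mk gs ⊕ h)) → ∀ {x} → x ∈ rightOpts (mk gs) hs → P x
  rightOpts-elim {_ ∷ _} f (here refl) = f (here refl)
  rightOpts-elim {_ ∷ _} f (there x∈xs) = rightOpts-elim (f ∘ there) x∈xs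

typeOf-⊕-identityʳ′ : Acc _◃_ G → typeOf (G ⊕ mk []) ≡ typeOf G
typeOf-⊕-identityʳ′ {G} (acc rs) = typeOf-cong (G ⊕ mk []) G
  (◃-⊕-elim {P = _∈ᵀ G} G (mk []) (λ g◃G → -, g◃G , typeOf-⊕-identityʳ′ (rs g◃G)) λ { (opt ()) })
  (λ g◃G → -, ◃-⊕⁺ˡ (mk []) g◃G , sym (typeOf-⊕-identityʳ′ (rs g◃G)))

typeOf-⊕-identityʳ : ∀ G → typeOf (G ⊕ mk []) ≡ typeOf G
typeOf-⊕-identityʳ G = typeOf-⊕-identityʳ′ (◃-wellFounded G)

typeOf-⊕-comm′ : Acc _◃_ G → Acc _◃_ H → typeOf (G ⊕ H) ≡ typeOf (H ⊕ G)
typeOf-⊕-comm′ {G} {H} aG@(acc rsG) aH@(acc rsH) = typeOf-cong (G ⊕ H) (H ⊕ G)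
  (◃-⊕-elim {P = _∈ᵀ H ⊕ G} G H (λ g◃G → -, ◃-⊕⁺ʳ H g◃G , typeOf-⊕-comm′ (rsG g◃G) aH)
                                 (λ h◃H → -, ◃-⊕⁺ˡ G h◃H , typeOf-⊕-comm′ aG (rsH h◃H)))
  (◃-⊕-elim {P = _∈ᵀ G ⊕ H} H G (λ h◃H → -, ◃-⊕⁺ʳ G h◃H , typeOf-⊕-comm′ (rsH h◃H) aG)
                                 (λ g◃G → -, ◃-⊕⁺ˡ H g◃G , typeOf-⊕-comm′ aH (rsG g◃G)))

typeOf-⊕-comm : ∀ G H → typeOf (G ⊕ H) ≡ typeOf (H ⊕ G)
typeOf-⊕-comm G H = typeOf-⊕-comm′ (◃-wellFounded G) (◃-wellFounded H)

typeOf-⊕-assoc′ : Acc _◃_ G → Acc _◃_ H → Acc _◃_ K → typeOf ((G ⊕ H) ⊕ K) ≡ typeOf (G ⊕ (H ⊕ K))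
typeOf-⊕-assoc′ {G} {H} {K} aG@(acc rsG) aH@(acc rsH) aK@(acc rsK) =
  typeOf-cong ((G ⊕ H) ⊕ K) (G ⊕ (H ⊕ K))
    (◃-⊕-elim {P = _∈ᵀ G ⊕ (H ⊕ K)} (G ⊕ H) K
      (◃-⊕-elim {P = λ x → x ⊕ K ∈ᵀ G ⊕ (H ⊕ K)} G H
        (λ g◃G → -, ◃-⊕⁺ˡ (H ⊕ K) g◃G , typeOf-⊕-assoc′ (rsG g◃G) aH aK)
        (λ h◃H → -, ◃-⊕⁺ʳ G (◃-⊕⁺ˡ K h◃H) , typeOf-⊕-assoc′ aG (rsH h◃H) aK))
      (λ k◃K → -, ◃-⊕⁺ʳ G (◃-⊕⁺ʳ H k◃K) , typeOf-⊕-assoc′ aG aH (rsK k◃K)))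
    (◃-⊕-elim {P = _∈ᵀ (G ⊕ H) ⊕ K} G (H ⊕ K)
      (λ g◃G → -, ◃-⊕⁺ˡ K (◃-⊕⁺ˡ H g◃G) , sym (typeOf-⊕-assoc′ (rsG g◃G) aH aK))
      (◃-⊕-elim {P = λ x → G ⊕ x ∈ᵀ (G ⊕ H) ⊕ K} H K
        (λ h◃H → -, ◃-⊕⁺ˡ K (◃-⊕⁺ʳ G h◃H) , sym (typeOf-⊕-assoc′ aG (rsH h◃H) aK))
        (λ k◃K → -, ◃-⊕⁺ʳ (G ⊕ H) k◃K , sym (typeOf-⊕-assoc′ aG aH (rsK k◃K)))))

typeOf-⊕-assoc : ∀ G H K → typeOf ((G ⊕ H) ⊕ K) ≡ typeOf (G ⊕ (H ⊕ K))
typeOf-⊕-assoc G H K = typeOf-⊕-assoc′ (◃-wellFounded G) (◃-wellFounded H) (◃-wellFounded K)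

-- Summands of known type

mutual
  𝒫⊕≢𝒩⇒≢𝒩′ : Acc _◃_ H → Acc _◃_ K → typeOf H ≡ 𝒫 → typeOf K ≢ 𝒩 → typeOf (H ⊕ K) ≢ 𝒩
  𝒫⊕≢𝒩⇒≢𝒩′ {H} {K} aH@(acc rsH) aK@(acc rsK) H𝒫 K≢𝒩 = ≢𝒩-intro (◃-⊕-elim H K
    (λ h◃H → 𝒪⊕≢𝒩⇒≢𝒫′ (rsH h◃H) aK (𝒫-elim H H𝒫 h◃H) K≢𝒩)
    (λ k◃K → 𝒫⊕≢𝒫⇒≢𝒫′ aH (rsK k◃K) H𝒫 (≢𝒩-elim K≢𝒩 k◃K)))

  𝒫⊕≢𝒫⇒≢𝒫′ : Acc _◃_ H → Acc _◃_ K → typeOf H ≡ 𝒫 → typeOf K ≢ 𝒫 → typeOf (H ⊕ K) ≢ 𝒫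
  𝒫⊕≢𝒫⇒≢𝒫′ {H} {K} aH (acc rsK) H𝒫 K≢𝒫 =
    let k , k◃K , k≢𝒪 = ≢𝒫-elim K K≢𝒫
    in ≢𝒫-intro (◃-⊕⁺ʳ H k◃K) (𝒫⊕≢𝒪⇒≢𝒪′ aH (rsK k◃K) H𝒫 k≢𝒪)

  𝒫⊕≢𝒪⇒≢𝒪′ : Acc _◃_ H → Acc _◃_ K → typeOf H ≡ 𝒫 → typeOf K ≢ 𝒪 → typeOf (H ⊕ K) ≢ 𝒪
  𝒫⊕≢𝒪⇒≢𝒪′ {H} {K} aH (acc rsK) H𝒫 K≢𝒪 with ≢𝒪-elim K K≢𝒪
  ... | inj₁ refl = ≡-≢-trans (trans (typeOf-⊕-identityʳ H) H𝒫) λ ()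
  ... | inj₂ (k , k◃K , k≢𝒩) = ≢𝒪-intro (◃-⊕⁺ʳ H k◃K) (𝒫⊕≢𝒩⇒≢𝒩′ aH (rsK k◃K) H𝒫 k≢𝒩)

  𝒪⊕≢𝒩⇒≢𝒫′ : Acc _◃_ H → Acc _◃_ K → typeOf H ≡ 𝒪 → typeOf K ≢ 𝒩 → typeOf (H ⊕ K) ≢ 𝒫
  𝒪⊕≢𝒩⇒≢𝒫′ {H} {K} (acc rsH) aK H𝒪 K≢𝒩 =
    let (h , h◃H) , all𝒩 = 𝒪-elim H H𝒪
    in ≢𝒫-intro (◃-⊕⁺ˡ K h◃H) (𝒩⊕≢𝒩⇒≢𝒪′ (rsH h◃H) aK (all𝒩 h◃H) K≢𝒩)

  𝒩⊕≢𝒩⇒≢𝒪′ : Acc _◃_ H → Acc _◃_ K → typeOf H ≡ 𝒩 → typeOf K ≢ 𝒩 → typeOf (H ⊕ K) ≢ 𝒪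
  𝒩⊕≢𝒩⇒≢𝒪′ {H} {K} (acc rsH) aK H𝒩 K≢𝒩 =
    let h , h◃H , h𝒫 = 𝒩-elim H H𝒩
    in ≢𝒪-intro (◃-⊕⁺ˡ K h◃H) (𝒫⊕≢𝒩⇒≢𝒩′ (rsH h◃H) aK h𝒫 K≢𝒩)

𝒫⊕≢𝒫⇒≢𝒫 : ∀ H K → typeOf H ≡ 𝒫 → typeOf K ≢ 𝒫 → typeOf (H ⊕ K) ≢ 𝒫
𝒫⊕≢𝒫⇒≢𝒫 H K = 𝒫⊕≢𝒫⇒≢𝒫′ (◃-wellFounded H) (◃-wellFounded K)

𝒫⊕≢𝒪⇒≢𝒪 : ∀ H K → typeOf H ≡ 𝒫 → typeOf K ≢ 𝒪 → typeOf (H ⊕ K) ≢ 𝒪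
𝒫⊕≢𝒪⇒≢𝒪 H K = 𝒫⊕≢𝒪⇒≢𝒪′ (◃-wellFounded H) (◃-wellFounded K)

𝒪⊕≢𝒩⇒≢𝒫 : ∀ H K → typeOf H ≡ 𝒪 → typeOf K ≢ 𝒩 → typeOf (H ⊕ K) ≢ 𝒫
𝒪⊕≢𝒩⇒≢𝒫 H K = 𝒪⊕≢𝒩⇒≢𝒫′ (◃-wellFounded H) (◃-wellFounded K)

𝒩⊕≢𝒩⇒≢𝒪 : ∀ H K → typeOf H ≡ 𝒩 → typeOf K ≢ 𝒩 → typeOf (H ⊕ K) ≢ 𝒪
𝒩⊕≢𝒩⇒≢𝒪 H K = 𝒩⊕≢𝒩⇒≢𝒪′ (◃-wellFounded H) (◃-wellFounded K)

𝒩⊕≢𝒪⇒≢𝒫 : ∀ H K → typeOf H ≡ 𝒩 → typeOf K ≢ 𝒪 → typeOf (H ⊕ K) ≢ 𝒫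
𝒩⊕≢𝒪⇒≢𝒫 H K H𝒩 K≢𝒪 =
  let h , h◃H , h𝒫 = 𝒩-elim H H𝒩
  in ≢𝒫-intro (◃-⊕⁺ˡ K h◃H) (𝒫⊕≢𝒪⇒≢𝒪 h K h𝒫 K≢𝒪)

mutual
  ⊕𝒬⇒≢𝒫′ : Acc _◃_ H → Acc _◃_ K → typeOf K ≡ 𝒬 → typeOf (H ⊕ K) ≢ 𝒫
  ⊕𝒬⇒≢𝒫′ {H} {K} aH aK K𝒬 with typeOf H in H≡
  ... | 𝒫 = 𝒫⊕≢𝒫⇒≢𝒫 H K H≡ (≡-≢-trans K𝒬 λ ())
  ... | 𝒩 = 𝒩⊕≢𝒪⇒≢𝒫 H K H≡ (≡-≢-trans K𝒬 λ ())
  ... | 𝒪 = 𝒪⊕≢𝒩⇒≢𝒫 H K H≡ (≡-≢-trans K𝒬 λ ())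
  ... | 𝒬 = 𝒬⊕𝒬⇒≢𝒫′ aH aK H≡ K𝒬

  𝒬⊕𝒬⇒≢𝒩′ : Acc _◃_ H → Acc _◃_ K → typeOf H ≡ 𝒬 → typeOf K ≡ 𝒬 → typeOf (H ⊕ K) ≢ 𝒩
  𝒬⊕𝒬⇒≢𝒩′ {H} {K} aH@(acc rsH) aK@(acc rsK) H𝒬 K𝒬 = ≢𝒩-intro (◃-⊕-elim H K
    (λ h◃H → ⊕𝒬⇒≢𝒫′ (rsH h◃H) aK K𝒬)
    (λ {k} k◃K → ≡-≢-trans (typeOf-⊕-comm H k) (⊕𝒬⇒≢𝒫′ (rsK k◃K) aH H𝒬)))

  𝒬⊕𝒬⇒≢𝒫′ : Acc _◃_ H → Acc _◃_ K → typeOf H ≡ 𝒬 → typeOf K ≡ 𝒬 → typeOf (H ⊕ K) ≢ 𝒫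
  𝒬⊕𝒬⇒≢𝒫′ {H} {K} (acc rsH) (acc rsK) H𝒬 K𝒬 with 𝒬-elim H H𝒬 | 𝒬-elim K K𝒬
  ... | h , h◃H , inj₁ h𝒩 | _ =
    ≢𝒫-intro (◃-⊕⁺ˡ K h◃H) (𝒩⊕≢𝒩⇒≢𝒪 h K h𝒩 (≡-≢-trans K𝒬 λ ()))
  ... | _ | k , k◃K , inj₁ k𝒩 =
    ≢𝒫-intro (◃-⊕⁺ʳ H k◃K) (≡-≢-trans (typeOf-⊕-comm H k) (𝒩⊕≢𝒩⇒≢𝒪 k H k𝒩 (≡-≢-trans H𝒬 λ ())))
  ... | h , h◃H , inj₂ h𝒬 | k , k◃K , inj₂ k𝒬 =
    ≢𝒫-intro (◃-⊕⁺ˡ K h◃H) (≢𝒪-intro (◃-⊕⁺ʳ h k◃K) (𝒬⊕𝒬⇒≢𝒩′ (rsH h◃H) (rsK k◃K) h𝒬 k𝒬))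

⊕𝒬⇒≢𝒫 : ∀ H K → typeOf K ≡ 𝒬 → typeOf (H ⊕ K) ≢ 𝒫
⊕𝒬⇒≢𝒫 H K = ⊕𝒬⇒≢𝒫′ (◃-wellFounded H) (◃-wellFounded K)

𝒬⊕⇒≢𝒫 : ∀ H K → typeOf H ≡ 𝒬 → typeOf (H ⊕ K) ≢ 𝒫
𝒬⊕⇒≢𝒫 H K H𝒬 = ≡-≢-trans (typeOf-⊕-comm H K) (⊕𝒬⇒≢𝒫 K H H𝒬)

-- Two and three copies of a game

mutual
  𝒩⇒⊕self≢𝒩′ : Acc _◃_ G → typeOf G ≡ 𝒩 → typeOf (G ⊕ G) ≢ 𝒩
  𝒩⇒⊕self≢𝒩′ {G} (acc rs) G𝒩 =
    ≢𝒩-intro (◃-⊕-elim G G left λ {g} g◃G → ≡-≢-trans (typeOf-⊕-comm G g) (left g◃G))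
    where
    left : g ◃ G → typeOf (g ⊕ G) ≢ 𝒫
    left {g} g◃G with typeOf g in g≡
    ... | 𝒫 = 𝒫⊕≢𝒫⇒≢𝒫 g G g≡ (≡-≢-trans G𝒩 λ ())
    ... | 𝒩 = 𝒩⊕≢𝒪⇒≢𝒫 g G g≡ (≡-≢-trans G𝒩 λ ())
    ... | 𝒪 = ≢𝒫-intro (◃-⊕⁺ʳ g g◃G) (𝒪⇒⊕self≢𝒪′ (rs g◃G) g≡)
    ... | 𝒬 = 𝒬⊕⇒≢𝒫 g G g≡

  𝒪⇒⊕self≢𝒪′ : Acc _◃_ G → typeOf G ≡ 𝒪 → typeOf (G ⊕ G) ≢ 𝒪
  𝒪⇒⊕self≢𝒪′ {G} (acc rs) G𝒪 with 𝒪-elim G G𝒪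
  ... | (g₁ , g₁◃G) , all𝒩 with rs g₁◃G
  ...   | acc rs₁ = ≢𝒪-intro (◃-⊕⁺ˡ G g₁◃G) (≢𝒩-intro (◃-⊕-elim g₁ G left right))
    where
    left : g ◃ g₁ → typeOf (g ⊕ G) ≢ 𝒫
    left {g} g◃g₁ with typeOf g in g≡
    ... | 𝒫 = 𝒫⊕≢𝒫⇒≢𝒫 g G g≡ (≡-≢-trans G𝒪 λ ())
    ... | 𝒩 = ≢𝒫-intro (◃-⊕⁺ʳ g g₁◃G) (≢𝒪-intro (◃-⊕⁺ʳ g g◃g₁) (𝒩⇒⊕self≢𝒩′ (rs₁ g◃g₁) g≡))
    ... | 𝒪 = 𝒪⊕≢𝒩⇒≢𝒫 g G g≡ (≡-≢-trans G𝒪 λ ())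
    ... | 𝒬 = 𝒬⊕⇒≢𝒫 g G g≡
    right : g ◃ G → typeOf (g₁ ⊕ g) ≢ 𝒫
    right g◃G = 𝒩⊕≢𝒪⇒≢𝒫 g₁ _ (all𝒩 g₁◃G) (≡-≢-trans (all𝒩 g◃G) λ ())

𝒩⇒⊕self≢𝒩 : ∀ G → typeOf G ≡ 𝒩 → typeOf (G ⊕ G) ≢ 𝒩
𝒩⇒⊕self≢𝒩 G = 𝒩⇒⊕self≢𝒩′ (◃-wellFounded G)

𝒪⇒⊕self≢𝒪 : ∀ G → typeOf G ≡ 𝒪 → typeOf (G ⊕ G) ≢ 𝒪
𝒪⇒⊕self≢𝒪 G = 𝒪⇒⊕self≢𝒪′ (◃-wellFounded G)

⊕³≢𝒩′ : Acc _◃_ G → typeOf (G ⊕ G ⊕ G) ≢ 𝒩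
⊕³≢𝒩′ {G} (acc rs) = ≢𝒩-intro (◃-⊕-elim (G ⊕ G) G (◃-⊕-elim G G first second) third)
  where
  first : g ◃ G → typeOf (g ⊕ G ⊕ G) ≢ 𝒫
  first {g} g◃G = ≢𝒫-intro (◃-⊕⁺ˡ G (◃-⊕⁺ʳ g g◃G)) (≢𝒪-intro (◃-⊕⁺ʳ (g ⊕ g) g◃G) (⊕³≢𝒩′ (rs g◃G)))
  second : g ◃ G → typeOf (G ⊕ g ⊕ G) ≢ 𝒫
  second {g} g◃G = ≢𝒫-intro (◃-⊕⁺ˡ G (◃-⊕⁺ˡ g g◃G)) (≢𝒪-intro (◃-⊕⁺ʳ (g ⊕ g) g◃G) (⊕³≢𝒩′ (rs g◃G)))
  third : g ◃ G → typeOf (G ⊕ G ⊕ g) ≢ 𝒫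
  third {g} g◃G = ≢𝒫-intro (◃-⊕⁺ˡ g (◃-⊕⁺ʳ G g◃G)) (≢𝒪-intro (◃-⊕⁺ˡ g (◃-⊕⁺ˡ g g◃G)) (⊕³≢𝒩′ (rs g◃G)))

⊕³≢𝒩 : ∀ G → typeOf (G ⊕ G ⊕ G) ≢ 𝒩
⊕³≢𝒩 G = ⊕³≢𝒩′ (◃-wellFounded G)

-- An option of (G ⊕ G) ⊕ y either keeps the 𝒬-summand G ⊕ G or is x ⊕ y with x ≢ 𝒪 and y of type 𝒩.
𝒪∧⊕self𝒬⇒⊕³≢𝒪 : ∀ G → typeOf G ≡ 𝒪 → typeOf (G ⊕ G) ≡ 𝒬 → typeOf (G ⊕ G ⊕ G) ≢ 𝒪
𝒪∧⊕self𝒬⇒⊕³≢𝒪 G G𝒪 GG𝒬 with 𝒪-elim G G𝒪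
... | (y , y◃G) , all𝒩 = ≢𝒪-intro (◃-⊕⁺ʳ (G ⊕ G) y◃G) (≢𝒩-intro (◃-⊕-elim (G ⊕ G) y
      (λ {x} x◃GG → ≡-≢-trans (typeOf-⊕-comm x y) (𝒩⊕≢𝒪⇒≢𝒫 y x (all𝒩 y◃G) (options≢𝒪 x◃GG)))
      (λ {y′} _ → 𝒬⊕⇒≢𝒫 (G ⊕ G) y′ GG𝒬)))
  where
  G≢𝒩 : typeOf G ≢ 𝒩
  G≢𝒩 = ≡-≢-trans G𝒪 λ ()
  options≢𝒪 : ∀ {x} → x ◃ G ⊕ G → typeOf x ≢ 𝒪
  options≢𝒪 = ◃-⊕-elim G G (λ {g} g◃G → 𝒩⊕≢𝒩⇒≢𝒪 g G (all𝒩 g◃G) G≢𝒩)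
                           (λ {g} g◃G → ≡-≢-trans (typeOf-⊕-comm G g) (𝒩⊕≢𝒩⇒≢𝒪 g G (all𝒩 g◃G) G≢𝒩))

-- Every option of (G ⊕ G) ⊕ y still has the 𝒬-summand G.
𝒬⇒⊕³≢𝒪 : ∀ G → typeOf G ≡ 𝒬 → typeOf (G ⊕ G ⊕ G) ≢ 𝒪
𝒬⇒⊕³≢𝒪 G G𝒬 with 𝒬-elim G G𝒬
... | y , y◃G , _ = ≢𝒪-intro (◃-⊕⁺ʳ (G ⊕ G) y◃G) (≢𝒩-intro (◃-⊕-elim (G ⊕ G) y
      (◃-⊕-elim G G
        (λ {g} _ → ≡-≢-trans (typeOf-⊕-assoc g G y) (≡-≢-trans (typeOf-⊕-comm g (G ⊕ y))
                     (≡-≢-trans (typeOf-⊕-assoc G y g) (𝒬⊕⇒≢𝒫 G (y ⊕ g) G𝒬))))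
        (λ {g} _ → ≡-≢-trans (typeOf-⊕-assoc G g y) (𝒬⊕⇒≢𝒫 G (g ⊕ y) G𝒬)))
      (λ {y′} _ → ≡-≢-trans (typeOf-⊕-assoc G G y′) (𝒬⊕⇒≢𝒫 G (G ⊕ y′) G𝒬))))

⊕³≢𝒪 : ∀ G → typeOf (G ⊕ G ⊕ G) ≢ 𝒪
⊕³≢𝒪 G with typeOf G in G≡
... | 𝒫 = ≡-≢-trans (typeOf-⊕-comm (G ⊕ G) G) (𝒫⊕≢𝒪⇒≢𝒪 G (G ⊕ G) G≡ (𝒫⊕≢𝒪⇒≢𝒪 G G G≡ (≡-≢-trans G≡ λ ())))
... | 𝒩 = ≡-≢-trans (typeOf-⊕-comm (G ⊕ G) G) (𝒩⊕≢𝒩⇒≢𝒪 G (G ⊕ G) G≡ (𝒩⇒⊕self≢𝒩 G G≡))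
... | 𝒬 = 𝒬⇒⊕³≢𝒪 G G≡
... | 𝒪 with typeOf (G ⊕ G) in GG≡
...   | 𝒫 = contradiction GG≡ (𝒪⊕≢𝒩⇒≢𝒫 G G G≡ (≡-≢-trans G≡ λ ()))
...   | 𝒩 = 𝒩⊕≢𝒩⇒≢𝒪 (G ⊕ G) G GG≡ (≡-≢-trans G≡ λ ())
...   | 𝒪 = contradiction GG≡ (𝒪⇒⊕self≢𝒪 G G≡)
...   | 𝒬 = 𝒪∧⊕self𝒬⇒⊕³≢𝒪 G G≡ GG≡

⊕³≡𝒫⊎𝒬 : ∀ G → typeOf (G ⊕ G ⊕ G) ≡ 𝒫 ⊎ typeOf (G ⊕ G ⊕ G) ≡ 𝒬
⊕³≡𝒫⊎𝒬 G with typeOf (G ⊕ G ⊕ G) in e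
... | 𝒫 = inj₁ refl
... | 𝒩 = contradiction e (⊕³≢𝒩 G)
... | 𝒪 = contradiction e (⊕³≢𝒪 G)
... | 𝒬 = inj₂ refl

𝒬⇒⊕³≡𝒬 : ∀ G → typeOf G ≡ 𝒬 → typeOf (G ⊕ G ⊕ G) ≡ 𝒬
𝒬⇒⊕³≡𝒬 G G𝒬 with ⊕³≡𝒫⊎𝒬 G
... | inj₁ ⊕³𝒫 = contradiction ⊕³𝒫 (⊕𝒬⇒≢𝒫 (G ⊕ G) G G𝒬)
... | inj₂ ⊕³𝒬 = ⊕³𝒬

only : Game → Game
only G = mk (G ∷ [])

∗0 ∗1 ∗2 : Game
∗0 = mk []
∗1 = only ∗0
∗2 = mk (∗0 ∷ ∗1 ∷ [])

mainTheorem10 :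
    (∀ (G : Game) → (typeOf G ≡ 𝒫 ⊎ typeOf G ≡ 𝒩 ⊎ typeOf G ≡ 𝒪) →
      (typeOf (G ⊕ G ⊕ G) ≡ 𝒫 ⊎ typeOf (G ⊕ G ⊕ G) ≡ 𝒬))
    × (∀ (G : Game) → typeOf G ≡ 𝒬 → typeOf (G ⊕ G ⊕ G) ≡ 𝒬)
    × (∀ (t : GType) → (t ≡ 𝒫 ⊎ t ≡ 𝒩 ⊎ t ≡ 𝒪) →
      (∃ λ (G : Game) → typeOf G ≡ t × typeOf (G ⊕ G ⊕ G) ≡ 𝒫)
      × (∃ λ (G : Game) → typeOf G ≡ t × typeOf (G ⊕ G ⊕ G) ≡ 𝒬))
mainTheorem10 = (λ G _ → ⊕³≡𝒫⊎𝒬 G) , 𝒬⇒⊕³≡𝒬 , examples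
  where
  examples : ∀ t → (t ≡ 𝒫 ⊎ t ≡ 𝒩 ⊎ t ≡ 𝒪) →
             (∃ λ G → typeOf G ≡ t × typeOf (G ⊕ G ⊕ G) ≡ 𝒫)
             × (∃ λ G → typeOf G ≡ t × typeOf (G ⊕ G ⊕ G) ≡ 𝒬)
  examples 𝒫 (inj₁ refl)        = (∗0 , refl , refl)      , (only (only ∗2) , refl , refl)
  examples 𝒩 (inj₂ (inj₁ refl)) = (∗1 , refl , refl)      , (∗2 , refl , refl)
  examples 𝒪 (inj₂ (inj₂ refl)) = (only ∗1 , refl , refl) , (only ∗2 , refl , refl)
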